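{- For every natural number $k$ (including $k=0$), $St(k+4,k)=(k+1)(k+28)/2$.
   Context: A strong fixed point of a permutation $\pi$ of $[n]$ is an element $k$ such that $\pi^{ -1}(j)<\pi^{ -1}(k)$ for all $j<k$ and $\pi^{ -1}(i)>\pi^{ -1}(k)$ for all $i>k$. $St(n,k)$ denotes the number of permutations of $[n]$ with exactly $k$ strong fixed points. -}

module Defs where

open import Data.Nat using (ℕ; zero; suc)
open import Data.Fin using (Fin; _<_; _<?_)
open import Data.Fin.Properties using (all?; _≟_)
open import Data.Vec using (Vec; []; _∷_; lookup)
open import Data.List using (List; []; _∷_; concatMap; map; filter; length)
open import Data.List using () renaming (allFin to allFinL)
open import Data.Product using (_×_)
open import Relation.Binary.PropositionalEquality using (_≡_)
open import Relation.Nullary using (Dec)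
open import Relation.Nullary.Decidable using (_×-dec_; _→-dec_)
import Data.Nat.Properties as ℕP

allVecs : (n m : ℕ) → List (Vec (Fin n) m)
allVecs n zero = [] ∷ []
allVecs n (suc m) = concatMap (λ x → map (x ∷_) (allVecs n m)) (allFinL n)

-- A permutation π of [n] is given in one-line notation by the vector
-- v with lookup v i = π(i).  It is a permutation iff π is injective
-- (an injective map Fin n → Fin n is a bijection).
IsPerm : {n : ℕ} → Vec (Fin n) n → Set
IsPerm {n} v = ∀ (i j : Fin n) → lookup v i ≡ lookup v j → i ≡ j

isPerm? : {n : ℕ} (v : Vec (Fin n) n) → Dec (IsPerm v)
isPerm? v = all? λ i → all? λ j → (lookup v i ≟ lookup v j) →-dec (i ≟ j)

-- k is a strong fixed point of π: with a = π⁻¹(k) (the unique a with π(a) = k),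
-- every j < k has π⁻¹(j) < a and every i > k has π⁻¹(i) > a.
-- (π⁻¹(j) is the position p with π(p) = j, so we quantify over positions p.)
StrongFixed : {n : ℕ} → Vec (Fin n) n → Fin n → Set
StrongFixed {n} v k =
  ∀ (a : Fin n) → lookup v a ≡ k →
  ∀ (p : Fin n) → (lookup v p < k → p < a) × (k < lookup v p → a < p)

strongFixed? : {n : ℕ} (v : Vec (Fin n) n) (k : Fin n) → Dec (StrongFixed v k)
strongFixed? v k = all? λ a → (lookup v a ≟ k) →-dec all? λ p →
  ((lookup v p <? k) →-dec (p <? a)) ×-dec ((k <? lookup v p) →-dec (a <? p))

numStrongFixed : {n : ℕ} → Vec (Fin n) n → ℕ
numStrongFixed {n} v = length (filter (strongFixed? v) (allFinL n))

St : ℕ → ℕ → ℕ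
St n k = length (filter (λ v → isPerm? v ×-dec (numStrongFixed v ℕP.≟ k)) (allVecs n n))

module Submission where

open import Defs
open import Data.Nat using (ℕ; _+_; _*_)
open import Data.Nat.DivMod using (_/_)
open import Relation.Binary.PropositionalEquality using (_≡_)

open import Function using (_∘_)
open import Level using (0ℓ)
open import Data.Unit using (tt)
open import Data.Empty using (⊥-elim)
open import Data.Product using (_×_; _,_; proj₁; proj₂; ∃)
open import Data.Bool using (Bool; true; false; not; _∧_; _∨_; if_then_else_; T)
open import Data.Bool.Properties using (∧-zeroʳ; ∨-zeroʳ; ∧-assoc; ¬-not)
open import Data.Nat using (zero; suc; _∸_; _⊔_; _≤_; _<_; _≡ᵇ_; _≤ᵇ_; z≤n; s≤s; s≤s⁻¹; z<s; s<s)
open import Data.Nat.Properties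
open import Data.Nat.DivMod using (m*n/n≡m)
open import Data.Nat.Tactic.RingSolver using (solve-∀)
open import Data.Nat.ListAction using (sum)
open import Data.Nat.ListAction.Properties using (sum-++)
open import Data.Fin using (Fin; zero; suc; toℕ; fromℕ<; inject≤; punchOut) renaming (_<_ to _<ᶠ_)
open import Data.Fin.Properties using (toℕ-injective; toℕ<n; toℕ-fromℕ<; toℕ-inject≤; inject≤-injective;
  injective⇒≤; punchOut-injective; any?)
import Data.Fin.Properties as FinP
open import Data.Vec using (Vec; []; _∷_; lookup; toList)
open import Data.List using (List; []; _∷_; _++_; length; map; filter; concatMap; tabulate)
  renaming (allFin to allFinL)
open import Data.List.Properties using (map-++; filter-++; length-++; map-tabulate; tabulate-cong)
open import Relation.Nullary using (Dec; yes; no; does)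
open import Relation.Unary using (Pred; Decidable)
open import Relation.Binary using (tri<; tri≈; tri>)
open import Relation.Binary.PropositionalEquality

-- A permutation splits into blocks at the positions c where its first c
-- values are exactly 0, …, c-1; strong fixed points are the blocks of length 1.
-- So the first block is either a strong fixed point (the rest is a permutation
-- with one strong fixed point fewer) or a block of length c ≥ 2 (the rest has
-- the same strong fixed points).  For S e k = St(e + k, k) this gives
--     S e k = [k ≥ 1] S e (k-1) + Σ_{first blocks, length c ∈ [2, e]} S (e - c) k.
-- Enumeration finds 1, 3, 13 first blocks of lengths 2, 3, 4, so
-- S 4 k = [k ≥ 1] S 4 (k-1) + S 2 k + 3 S 1 k + 13 S 0 k = [k ≥ 1] S 4 (k-1) + k + 14.

bit : Bool → ℕ
bit true = 1
bit false = 0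

bit≤1 : ∀ c → bit c ≤ 1
bit≤1 true = ≤-refl
bit≤1 false = z≤n

T-true : ∀ {c} → c ≡ true → T c
T-true refl = tt

true-T : ∀ {c} → T c → c ≡ true
true-T {true} _ = refl

∧-true : ∀ {c d} → c ∧ d ≡ true → c ≡ true × d ≡ true
∧-true {true} {true} _ = refl , refl

∨-false : ∀ {c d} → c ∨ d ≡ false → c ≡ false × d ≡ false
∨-false {false} {false} _ = refl , refl

not-true : ∀ {c} → not c ≡ true → c ≡ false
not-true {false} _ = refl

≡ᵇ-refl : ∀ m → (m ≡ᵇ m) ≡ true
≡ᵇ-refl zero = refl
≡ᵇ-refl (suc m) = ≡ᵇ-refl m

≡ᵇ-false : ∀ m n → m ≢ n → (m ≡ᵇ n) ≡ false
≡ᵇ-false m n m≢n = ¬-not (λ e → m≢n (≡ᵇ⇒≡ m n (T-true e)))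

-- _≤ᵇ_ is defined through _<ᵇ_, so this shift needs a case split.
≤ᵇ-suc : ∀ x y → (suc x ≤ᵇ suc y) ≡ (x ≤ᵇ y)
≤ᵇ-suc zero y = refl
≤ᵇ-suc (suc x) y = refl

≤ᵇ-false : ∀ m n → (m ≤ᵇ n) ≡ false → n < m
≤ᵇ-false m n eq = ≰⇒> (λ m≤n → subst T eq (≤⇒≤ᵇ m≤n))

decides : ∀ {A : Set} (d : Dec A) (c : Bool) → (A → c ≡ true) → (c ≡ true → A) → does d ≡ c
decides (yes a) c sound complete = sym (sound a)
decides (no ¬a) true sound complete = ⊥-elim (¬a (complete refl))
decides (no ¬a) false sound complete = refl

sumTo : ℕ → (ℕ → ℕ) → ℕ
sumTo zero g = 0
sumTo (suc n) g = g 0 + sumTo n (g ∘ suc)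

sumTo-cong : ∀ n {g h : ℕ → ℕ} → (∀ x → x < n → g x ≡ h x) → sumTo n g ≡ sumTo n h
sumTo-cong zero eq = refl
sumTo-cong (suc n) eq = cong₂ _+_ (eq 0 z<s) (sumTo-cong n (λ x x<n → eq (suc x) (s<s x<n)))

sumTo-zero : ∀ n {g : ℕ → ℕ} → (∀ x → x < n → g x ≡ 0) → sumTo n g ≡ 0
sumTo-zero zero eq = refl
sumTo-zero (suc n) eq = cong₂ _+_ (eq 0 z<s) (sumTo-zero n (λ x x<n → eq (suc x) (s<s x<n)))

sumTo-+ : ∀ m n (g : ℕ → ℕ) → sumTo (m + n) g ≡ sumTo m g + sumTo n (λ y → g (m + y))
sumTo-+ zero n g = refl
sumTo-+ (suc m) n g = trans (cong (g 0 +_) (sumTo-+ m n (g ∘ suc))) (sym (+-assoc (g 0) _ _))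

concatTo : ℕ → (ℕ → List ℕ) → List ℕ
concatTo zero h = []
concatTo (suc n) h = h 0 ++ concatTo n (h ∘ suc)

weigh : (ℕ → ℕ) → List ℕ → ℕ
weigh w cs = sum (map w cs)

weigh-concatTo : ∀ w n h → weigh w (concatTo n h) ≡ sumTo n (λ x → weigh w (h x))
weigh-concatTo w zero h = refl
weigh-concatTo w (suc n) h = begin
  sum (map w (h 0 ++ concatTo n (h ∘ suc)))          ≡⟨ cong sum (map-++ w (h 0) _) ⟩
  sum (map w (h 0) ++ map w (concatTo n (h ∘ suc)))  ≡⟨ sum-++ (map w (h 0)) _ ⟩
  weigh w (h 0) + weigh w (concatTo n (h ∘ suc))     ≡⟨ cong (weigh w (h 0) +_) (weigh-concatTo w n (h ∘ suc)) ⟩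
  weigh w (h 0) + sumTo n (λ x → weigh w (h (suc x))) ∎
  where open ≡-Reasoning

count : ℕ → ℕ → (List ℕ → Bool) → ℕ
count n zero f = bit (f [])
count n (suc m) f = sumTo n (λ x → count n m (λ l → f (x ∷ l)))

count-cong : ∀ n m {f g : List ℕ → Bool} → (∀ l → f l ≡ g l) → count n m f ≡ count n m g
count-cong n zero eq = cong bit (eq [])
count-cong n (suc m) eq = sumTo-cong n (λ x _ → count-cong n m (λ l → eq (x ∷ l)))

count-none : ∀ n m (f : List ℕ → Bool) → (∀ l → length l ≡ m → f l ≡ false) → count n m f ≡ 0
count-none n zero f h = cong bit (h [] refl)
count-none n (suc m) f h = sumTo-zero n (λ x _ → count-none n m _ (λ l e → h (x ∷ l) (cong suc e)))

count-used : ∀ n m (f : List ℕ → Bool) → count n m (λ l → not true ∧ f l) ≡ 0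
count-used n m f = count-none n m _ (λ _ _ → refl)

-- Reading a
-- word left to right, Scan U i b a K keeps: U the values already used, i the
-- current position, b = 1 + (largest value so far) (0 at the start), and a the
-- number of strong fixed points found.  The value x at position i is a strong
-- fixed point exactly when x = i and every earlier value is below i, i.e.
-- b ≤ i.

insert : ℕ → (ℕ → Bool) → ℕ → Bool
insert x U y = (y ≡ᵇ x) ∨ U y

none : ℕ → Bool
none _ = false

isSF : ℕ → ℕ → ℕ → Bool
isSF i b x = (x ≡ᵇ i) ∧ (b ≤ᵇ i)

Scan : (ℕ → Bool) → ℕ → ℕ → ℕ → ℕ → List ℕ → Bool
Scan U i b a K [] = a ≡ᵇ K
Scan U i b a K (x ∷ l) = not (U x) ∧ Scan (insert x U) (suc i) (b ⊔ suc x) (a + bit (isSF i b x)) K l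

Count : ℕ → ℕ → ℕ
Count n K = count n n (Scan none 0 0 0 K)

Fresh : (ℕ → Bool) → List ℕ → Bool
Fresh U [] = true
Fresh U (x ∷ l) = not (U x) ∧ Fresh (insert x U) l

sfCount : ℕ → ℕ → List ℕ → ℕ
sfCount i b [] = 0
sfCount i b (x ∷ l) = bit (isSF i b x) + sfCount (suc i) (b ⊔ suc x) l

Scan-split : ∀ U i b a K l → Scan U i b a K l ≡ Fresh U l ∧ (a + sfCount i b l ≡ᵇ K)
Scan-split U i b a K [] = cong (_≡ᵇ K) (sym (+-identityʳ a))
Scan-split U i b a K (x ∷ l) = begin
  not (U x) ∧ Scan U′ (suc i) b′ (a + s) K l
    ≡⟨ cong (not (U x) ∧_) (Scan-split U′ (suc i) b′ (a + s) K l) ⟩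
  not (U x) ∧ (Fresh U′ l ∧ (a + s + sfCount (suc i) b′ l ≡ᵇ K))
    ≡⟨ sym (∧-assoc (not (U x)) _ _) ⟩
  (not (U x) ∧ Fresh U′ l) ∧ (a + s + sfCount (suc i) b′ l ≡ᵇ K)
    ≡⟨ cong (λ c → (not (U x) ∧ Fresh U′ l) ∧ (c ≡ᵇ K)) (+-assoc a s _) ⟩
  (not (U x) ∧ Fresh U′ l) ∧ (a + (s + sfCount (suc i) b′ l) ≡ᵇ K) ∎
  where
  open ≡-Reasoning
  U′ = insert x U
  b′ = b ⊔ suc x
  s = bit (isSF i b x)

Injective : ∀ {m n} → (Fin m → Fin n) → Set
Injective f = ∀ i j → f i ≡ f j → i ≡ j

php : ∀ {n} (f : Fin n → Fin n) {m t} → m ≤ n →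
  (∀ q r → toℕ q < m → toℕ r < m → f q ≡ f r → q ≡ r) →
  (∀ q → toℕ q < m → toℕ (f q) < t) → m ≤ t
php {n} f {m} {t} m≤n inj into = injective⇒≤ {f = g} g-inj
  where
  small : ∀ q → toℕ (inject≤ q m≤n) < m
  small q = subst (_< m) (sym (toℕ-inject≤ q m≤n)) (toℕ<n q)
  g : Fin m → Fin t
  g q = fromℕ< (into (inject≤ q m≤n) (small q))
  g-inj : ∀ {q r} → g q ≡ g r → q ≡ r
  g-inj {q} {r} e = inject≤-injective m≤n m≤n q r (inj _ _ (small q) (small r) (toℕ-injective
    (trans (sym (toℕ-fromℕ< (into _ (small q)))) (trans (cong toℕ e) (toℕ-fromℕ< (into _ (small r)))))))

-- An injective endofunction of Fin n is onto: a missed value t would give an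
-- injection of Fin n into Fin (n-1) after punching t out.
surjective : ∀ {n} (f : Fin n → Fin n) → Injective f → ∀ t → ∃ λ a → f a ≡ t
surjective {suc n} f inj t with any? (λ a → f a FinP.≟ t)
... | yes found = found
... | no missing =
  ⊥-elim (1+n≰n (injective⇒≤ {f = avoid} (λ {a} {b} e → inj a b (punchOut-injective (apart a) (apart b) e))))
  where
  apart : ∀ a → t ≢ f a
  apart a t≡fa = missing (a , sym t≡fa)
  avoid : Fin (suc n) → Fin n
  avoid a = punchOut (apart a)

StrongFixedFn : ∀ {n} → (Fin n → Fin n) → Fin n → Set
StrongFixedFn {n} f k = ∀ a → f a ≡ k → ∀ p → (f p <ᶠ k → p <ᶠ a) × (k <ᶠ f p → a <ᶠ p)

Closed : ∀ {n} → (Fin n → Fin n) → Fin n → Set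
Closed f k = f k ≡ k × (∀ q → q <ᶠ k → f q <ᶠ k)

-- With a = π⁻¹(k): the positions before a carry values < k, so a ≤ k by
-- pigeonhole; the values below k sit before a, so k ≤ a by pigeonhole for π⁻¹.
strong⇒closed : ∀ {n} (f : Fin n → Fin n) → Injective f → ∀ k → StrongFixedFn f k → Closed f k
strong⇒closed {n} f inj k sf = subst (λ z → f z ≡ k) a≡k (pre-section k) , λ q q<k → before q (subst (q <ᶠ_) (sym a≡k) q<k)
  where
  pre : Fin n → Fin n
  pre t = proj₁ (surjective f inj t)
  pre-section : ∀ t → f (pre t) ≡ t
  pre-section t = proj₂ (surjective f inj t)
  a = pre k
  before : ∀ p → p <ᶠ a → f p <ᶠ k
  before p p<a with FinP.<-cmp (f p) k
  ... | tri< fp<k _ _ = fp<k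
  ... | tri≈ _ fp≡k _ = ⊥-elim (<-irrefl (cong toℕ (inj p a (trans fp≡k (sym (pre-section k))))) p<a)
  ... | tri> _ _ k<fp = ⊥-elim (<-asym p<a (proj₂ (sf a (pre-section k) p) k<fp))
  a≤k : toℕ a ≤ toℕ k
  a≤k = php f (<⇒≤ (toℕ<n a)) (λ q r _ _ → inj q r) before
  k≤a : toℕ k ≤ toℕ a
  k≤a = php pre (<⇒≤ (toℕ<n k))
    (λ t t′ _ _ e → trans (sym (pre-section t)) (trans (cong f e) (pre-section t′)))
    (λ t t<k → proj₁ (sf a (pre-section k) (pre t)) (subst (_<ᶠ k) (sym (pre-section t)) t<k))
  a≡k : a ≡ k
  a≡k = toℕ-injective (≤-antisym a≤k k≤a)

-- Conversely, if some p > k had π(p) < k, then sending the positions q < k to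
-- π(q) and position k to π(p) would inject k+1 positions into k values.
closed⇒strong : ∀ {n} (f : Fin n → Fin n) → Injective f → ∀ k → Closed f k → StrongFixedFn f k
closed⇒strong {n} f inj k (fk≡k , below) a fa≡k p =
  subst (λ z → (f p <ᶠ k → p <ᶠ z) × (k <ᶠ f p → z <ᶠ p)) (sym a≡k) (left , right)
  where
  a≡k : a ≡ k
  a≡k = inj a k (trans fa≡k (sym fk≡k))
  left : f p <ᶠ k → p <ᶠ k
  left fp<k with FinP.<-cmp p k
  ... | tri< p<k _ _ = p<k
  ... | tri≈ _ refl _ = ⊥-elim (<-irrefl (cong toℕ fk≡k) fp<k)
  ... | tri> _ _ k<p = ⊥-elim (1+n≰n (php replaced (toℕ<n k) replaced-inj replaced-into))
    where
    replaced : Fin n → Fin n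
    replaced q with q FinP.≟ k
    ... | yes _ = f p
    ... | no _ = f q
    earlier : ∀ q → toℕ q < suc (toℕ k) → q ≢ k → q <ᶠ k
    earlier q q≤k q≢k = ≤∧≢⇒< (s≤s⁻¹ q≤k) (q≢k ∘ toℕ-injective)
    replaced-into : ∀ q → toℕ q < suc (toℕ k) → toℕ (replaced q) < toℕ k
    replaced-into q q≤k with q FinP.≟ k
    ... | yes _ = fp<k
    ... | no q≢k = below q (earlier q q≤k q≢k)
    replaced-inj : ∀ q r → toℕ q < suc (toℕ k) → toℕ r < suc (toℕ k) → replaced q ≡ replaced r → q ≡ r
    replaced-inj q r q≤k r≤k e with q FinP.≟ k | r FinP.≟ k
    ... | yes q≡k | yes r≡k = trans q≡k (sym r≡k)
    ... | yes _ | no r≢k = ⊥-elim (<-asym k<p (subst (_<ᶠ k) (sym (inj p r e)) (earlier r r≤k r≢k)))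
    ... | no q≢k | yes _ = ⊥-elim (<-asym k<p (subst (_<ᶠ k) (inj q p e) (earlier q q≤k q≢k)))
    ... | no _ | no _ = inj q r e
  right : k <ᶠ f p → k <ᶠ p
  right k<fp with FinP.<-cmp p k
  ... | tri< p<k _ _ = ⊥-elim (<-asym k<fp (below p p<k))
  ... | tri≈ _ refl _ = ⊥-elim (<-irrefl (sym (cong toℕ fk≡k)) k<fp)
  ... | tri> _ _ k<p = k<p

values : ∀ {n m} → Vec (Fin n) m → List ℕ
values w = map toℕ (toList w)

length-filter-concatMap : ∀ {A B : Set} {P : Pred B 0ℓ} (D : Decidable P) (h : A → List B) xs →
  length (filter D (concatMap h xs)) ≡ sum (map (λ x → length (filter D (h x))) xs)
length-filter-concatMap D h [] = refl
length-filter-concatMap D h (x ∷ xs) = begin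
  length (filter D (h x ++ concatMap h xs))                    ≡⟨ cong length (filter-++ D (h x) _) ⟩
  length (filter D (h x) ++ filter D (concatMap h xs))         ≡⟨ length-++ (filter D (h x)) ⟩
  length (filter D (h x)) + length (filter D (concatMap h xs)) ≡⟨ cong (_ +_) (length-filter-concatMap D h xs) ⟩
  length (filter D (h x)) + sum (map (λ x → length (filter D (h x))) xs) ∎
  where open ≡-Reasoning

length-filter-map : ∀ {A B : Set} {P : Pred B 0ℓ} (D : Decidable P) (g : A → B) xs →
  length (filter D (map g xs)) ≡ length (filter (D ∘ g) xs)
length-filter-map D g [] = refl
length-filter-map D g (x ∷ xs) with does (D (g x))
... | true = cong suc (length-filter-map D g xs)
... | false = length-filter-map D g xs

length-filter-tabulate : ∀ {A : Set} {P : Pred A 0ℓ} (D : Decidable P) {m} (f : Fin m → A) →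
  length (filter D (tabulate f)) ≡ sum (tabulate (λ p → bit (does (D (f p)))))
length-filter-tabulate D {zero} f = refl
length-filter-tabulate D {suc m} f with does (D (f zero))
... | true = cong suc (length-filter-tabulate D (f ∘ suc))
... | false = length-filter-tabulate D (f ∘ suc)

sum-tabulate : ∀ n (g : Fin n → ℕ) (h : ℕ → ℕ) → (∀ x → g x ≡ h (toℕ x)) → sum (tabulate g) ≡ sumTo n h
sum-tabulate zero g h eq = refl
sum-tabulate (suc n) g h eq = cong₂ _+_ (eq zero) (sum-tabulate n (g ∘ suc) (h ∘ suc) (eq ∘ suc))

count-allVecs : ∀ n m {P : Pred (Vec (Fin n) m) 0ℓ} (D : Decidable P) (f : List ℕ → Bool) →
  (∀ w → does (D w) ≡ f (values w)) → length (filter D (allVecs n m)) ≡ count n m f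
count-allVecs n zero D f eq with does (D []) in d
... | true = cong bit (trans (sym d) (eq []))
... | false = cong bit (trans (sym d) (eq []))
count-allVecs n (suc m) D f eq = begin
  length (filter D (concatMap extend (allFinL n)))
    ≡⟨ length-filter-concatMap D extend (allFinL n) ⟩
  sum (map (λ x → length (filter D (extend x))) (tabulate (λ x → x)))
    ≡⟨ cong sum (map-tabulate {n = n} (λ x → x) (λ x → length (filter D (extend x)))) ⟩
  sum (tabulate (λ x → length (filter D (extend x))))
    ≡⟨ sum-tabulate n _ _ first ⟩
  sumTo n (λ y → count n m (λ l → f (y ∷ l))) ∎
  where
  open ≡-Reasoning
  extend : Fin n → List (Vec (Fin n) (suc m))
  extend x = map (x ∷_) (allVecs n m)
  first : ∀ x → length (filter D (extend x)) ≡ count n m (λ l → f (toℕ x ∷ l))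
  first x = trans (length-filter-map D (x ∷_) (allVecs n m)) (count-allVecs n m (D ∘ (x ∷_)) _ (eq ∘ (x ∷_)))

Fresh⇒ : ∀ {n m} U (w : Vec (Fin n) m) → Fresh U (values w) ≡ true →
  Injective (lookup w) × (∀ j → U (toℕ (lookup w j)) ≡ false)
Fresh⇒ U [] _ = (λ ()) , (λ ())
Fresh⇒ U (x ∷ w) e with ∧-true {not (U (toℕ x))} e
... | x-fresh , rest with Fresh⇒ (insert (toℕ x) U) w rest
...   | inj , avoids = inj′ , avoids′
  where
  differs : ∀ j → lookup w j ≢ x
  differs j wj≡x with () ← trans (sym (≡ᵇ-refl (toℕ x)))
    (subst (λ y → (toℕ y ≡ᵇ toℕ x) ≡ false) wj≡x (proj₁ (∨-false (avoids j))))
  inj′ : Injective (lookup (x ∷ w))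
  inj′ zero zero _ = refl
  inj′ zero (suc j) x≡wj = ⊥-elim (differs j (sym x≡wj))
  inj′ (suc i) zero wi≡x = ⊥-elim (differs i wi≡x)
  inj′ (suc i) (suc j) e = cong suc (inj i j e)
  avoids′ : ∀ j → U (toℕ (lookup (x ∷ w) j)) ≡ false
  avoids′ zero = not-true x-fresh
  avoids′ (suc j) = proj₂ (∨-false (avoids j))

Fresh⇐ : ∀ {n m} U (w : Vec (Fin n) m) → Injective (lookup w) → (∀ j → U (toℕ (lookup w j)) ≡ false) →
  Fresh U (values w) ≡ true
Fresh⇐ U [] _ _ = refl
Fresh⇐ U (x ∷ w) inj avoids rewrite avoids zero =
  Fresh⇐ (insert (toℕ x) U) w (λ i j e → FinP.suc-injective (inj (suc i) (suc j) e)) avoids′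
  where
  avoids′ : ∀ j → insert (toℕ x) U (toℕ (lookup w j)) ≡ false
  avoids′ j = cong₂ _∨_ (≡ᵇ-false _ _ (λ e → FinP.0≢1+n (inj zero (suc j) (toℕ-injective (sym e))))) (avoids (suc j))

isPerm-Fresh : ∀ {n} (v : Vec (Fin n) n) → does (isPerm? v) ≡ Fresh none (values v)
isPerm-Fresh v = decides (isPerm? v) _ (λ perm → Fresh⇐ none v perm (λ _ → refl)) (λ e → proj₁ (Fresh⇒ none v e))

sfAt : ∀ {n m} → ℕ → ℕ → Vec (Fin n) m → Fin m → Bool
sfAt i b (x ∷ w) zero = isSF i b (toℕ x)
sfAt i b (x ∷ w) (suc p) = sfAt (suc i) (b ⊔ suc (toℕ x)) w p

sfCount-tabulate : ∀ {n m} i b (w : Vec (Fin n) m) →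
  sum (tabulate (λ p → bit (sfAt i b w p))) ≡ sfCount i b (values w)
sfCount-tabulate i b [] = refl
sfCount-tabulate i b (x ∷ w) = cong (bit (isSF i b (toℕ x)) +_) (sfCount-tabulate (suc i) (b ⊔ suc (toℕ x)) w)

Tight : ∀ {n m} → ℕ → ℕ → Vec (Fin n) m → Fin m → Set
Tight i b w p = toℕ (lookup w p) ≡ i + toℕ p × b ≤ i + toℕ p × (∀ q → q <ᶠ p → toℕ (lookup w q) < i + toℕ p)

sfAt⇒Tight : ∀ {n m} i b (w : Vec (Fin n) m) p → sfAt i b w p ≡ true → Tight i b w p
sfAt⇒Tight i b (x ∷ w) zero e with ∧-true {toℕ x ≡ᵇ i} e
... | e₁ , e₂ = trans (≡ᵇ⇒≡ _ i (T-true e₁)) (sym (+-identityʳ i))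
              , subst (b ≤_) (sym (+-identityʳ i)) (≤ᵇ⇒≤ b i (T-true e₂))
              , λ q ()
sfAt⇒Tight i b (x ∷ w) (suc p) e with sfAt⇒Tight (suc i) (b ⊔ suc (toℕ x)) w p e
... | t₁ , t₂ , t₃ = trans t₁ shift , subst (b ≤_) shift (≤-trans (m≤m⊔n b _) t₂) , earlier
  where
  shift : suc i + toℕ p ≡ i + suc (toℕ p)
  shift = sym (+-suc i (toℕ p))
  earlier : ∀ q → q <ᶠ suc p → toℕ (lookup (x ∷ w) q) < i + suc (toℕ p)
  earlier zero _ = subst (toℕ x <_) shift (≤-trans (m≤n⊔m b _) t₂)
  earlier (suc q) (s<s q<p) = subst (toℕ (lookup w q) <_) shift (t₃ q q<p)

Tight⇒sfAt : ∀ {n m} i b (w : Vec (Fin n) m) p → Tight i b w p → sfAt i b w p ≡ true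
Tight⇒sfAt i b (x ∷ w) zero (t₁ , t₂ , _) rewrite +-identityʳ i | t₁ =
  cong₂ _∧_ (≡ᵇ-refl i) (true-T (≤⇒≤ᵇ t₂))
Tight⇒sfAt i b (x ∷ w) (suc p) (t₁ , t₂ , t₃) = Tight⇒sfAt (suc i) (b ⊔ suc (toℕ x)) w p
  ( trans t₁ shift
  , ⊔-lub (subst (b ≤_) shift t₂) (subst (toℕ x <_) shift (t₃ zero z<s))
  , λ q q<p → subst (toℕ (lookup w q) <_) shift (t₃ (suc q) (s<s q<p)) )
  where
  shift : i + suc (toℕ p) ≡ suc i + toℕ p
  shift = +-suc i (toℕ p)

strongFixed-sfAt : ∀ {n} (v : Vec (Fin n) n) → IsPerm v → ∀ k → does (strongFixed? v k) ≡ sfAt 0 0 v k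
strongFixed-sfAt v perm k = decides (strongFixed? v k) _
  (λ sf → let (fk≡k , below) = strong⇒closed (lookup v) perm k sf in Tight⇒sfAt 0 0 v k (cong toℕ fk≡k , z≤n , below))
  (λ e → let (t₁ , _ , t₃) = sfAt⇒Tight 0 0 v k e in closed⇒strong (lookup v) perm k (toℕ-injective t₁ , t₃))

numStrongFixed-sfCount : ∀ {n} (v : Vec (Fin n) n) → IsPerm v → numStrongFixed v ≡ sfCount 0 0 (values v)
numStrongFixed-sfCount {n} v perm = begin
  numStrongFixed v
    ≡⟨ length-filter-tabulate (strongFixed? v) (λ p → p) ⟩
  sum (tabulate (λ p → bit (does (strongFixed? v p))))
    ≡⟨ cong sum (tabulate-cong (λ p → cong bit (strongFixed-sfAt v perm p))) ⟩
  sum (tabulate (λ p → bit (sfAt 0 0 v p)))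
    ≡⟨ sfCount-tabulate 0 0 v ⟩
  sfCount 0 0 (values v) ∎
  where open ≡-Reasoning

St-Count : ∀ n K → St n K ≡ Count n K
St-Count n K = count-allVecs n n _ (Scan none 0 0 0 K) indicator
  where
  indicator : ∀ v → does (isPerm? v) ∧ does (numStrongFixed v ≟ K) ≡ Scan none 0 0 0 K (values v)
  indicator v = begin
    does (isPerm? v) ∧ (numStrongFixed v ≡ᵇ K)            ≡⟨ cong (_∧ (numStrongFixed v ≡ᵇ K)) (isPerm-Fresh v) ⟩
    Fresh none (values v) ∧ (numStrongFixed v ≡ᵇ K)       ≡⟨ counted ⟩
    Fresh none (values v) ∧ (sfCount 0 0 (values v) ≡ᵇ K) ≡⟨ sym (Scan-split none 0 0 0 K (values v)) ⟩
    Scan none 0 0 0 K (values v)                          ∎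
    where
    open ≡-Reasoning
    counted : Fresh none (values v) ∧ (numStrongFixed v ≡ᵇ K) ≡ Fresh none (values v) ∧ (sfCount 0 0 (values v) ≡ᵇ K)
    counted with Fresh none (values v) in fresh
    ... | false = refl
    ... | true = cong (_≡ᵇ K) (numStrongFixed-sfCount v (proj₁ (Fresh⇒ none v fresh)))

Scan-shift : ∀ U i b a K l → Scan U i b (suc a) (suc K) l ≡ Scan U i b a K l
Scan-shift U i b a K [] = refl
Scan-shift U i b a K (x ∷ l) = cong (not (U x) ∧_) (Scan-shift _ _ _ _ K l)

Scan-overshoot : ∀ U i b a l → Scan U i b (suc a) zero l ≡ false
Scan-overshoot U i b a [] = refl
Scan-overshoot U i b a (x ∷ l) = trans (cong (not (U x) ∧_) (Scan-overshoot _ _ _ _ l)) (∧-zeroʳ _)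

isSF-open : ∀ {i b} x → i < b → isSF i b x ≡ false
isSF-open {i} {b} x i<b with b ≤ᵇ i in eq
... | true = ⊥-elim (<⇒≱ i<b (≤ᵇ⇒≤ b i (T-true eq)))
... | false = ∧-zeroʳ (x ≡ᵇ i)

-- Budget: from position i with bound b, at most (remaining length) - (b - i)
-- further strong fixed points can occur, since positions i, …, b-1 are not.
Scan-bound : ∀ U i b a K l → Scan U i b a K l ≡ true → K ≤ a + (length l ∸ (b ∸ i))
Scan-bound U i b a K [] e = begin
  K                ≡⟨ sym (≡ᵇ⇒≡ a K (T-true e)) ⟩
  a                ≡⟨ sym (+-identityʳ a) ⟩
  a + 0            ≡⟨ cong (a +_) (sym (0∸n≡0 (b ∸ i))) ⟩
  a + (0 ∸ (b ∸ i)) ∎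
  where open ≤-Reasoning
Scan-bound U i b a K (x ∷ l) e =
  ≤-trans (Scan-bound _ _ _ _ K l (proj₂ (∧-true e))) (step (b ≤? i))
  where
  open ≤-Reasoning
  b′ = b ⊔ suc x
  step : Dec (b ≤ i) → a + bit (isSF i b x) + (length l ∸ (b′ ∸ suc i)) ≤ a + (suc (length l) ∸ (b ∸ i))
  step (yes b≤i) = begin
    a + bit (isSF i b x) + (length l ∸ (b′ ∸ suc i)) ≤⟨ +-mono-≤ (+-monoʳ-≤ a (bit≤1 _)) (m∸n≤m _ (b′ ∸ suc i)) ⟩
    a + 1 + length l                                 ≡⟨ +-assoc a 1 _ ⟩
    a + suc (length l)                               ≡⟨ cong (λ d → a + (suc (length l) ∸ d)) (sym (m≤n⇒m∸n≡0 b≤i)) ⟩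
    a + (suc (length l) ∸ (b ∸ i))                   ∎
  step (no b≰i) = begin
    a + bit (isSF i b x) + (length l ∸ (b′ ∸ suc i))
      ≡⟨ cong (λ c → a + bit c + (length l ∸ (b′ ∸ suc i))) (isSF-open x i<b) ⟩
    a + 0 + (length l ∸ (b′ ∸ suc i))
      ≡⟨ cong (_+ (length l ∸ (b′ ∸ suc i))) (+-identityʳ a) ⟩
    a + (length l ∸ (b′ ∸ suc i))
      ≤⟨ +-monoʳ-≤ a (∸-monoʳ-≤ (length l) (∸-monoˡ-≤ (suc i) (m≤m⊔n b (suc x)))) ⟩
    a + (length l ∸ (b ∸ suc i))
      ≡⟨ cong (λ d → a + (suc (length l) ∸ d)) (sym (+-∸-assoc 1 {b} {suc i} i<b)) ⟩
    a + (suc (length l) ∸ (b ∸ i)) ∎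
    where i<b = ≰⇒> b≰i

Scan-dead : ∀ n m U i b a K → a + (m ∸ (b ∸ i)) < K → count n m (Scan U i b a K) ≡ 0
Scan-dead n m U i b a K short = count-none n m _ (λ l len → ¬-not (λ accepted →
  <⇒≱ short (subst (λ d → K ≤ a + (d ∸ (b ∸ i))) len (Scan-bound U i b a K l accepted))))

isSF-shift : ∀ j i b x → isSF (j + i) (j + b) (j + x) ≡ isSF i b x
isSF-shift zero i b x = refl
isSF-shift (suc j) i b x = trans (cong ((j + x ≡ᵇ j + i) ∧_) (≤ᵇ-suc (j + b) (j + i))) (isSF-shift j i b x)

insert-shift : ∀ j x U y → insert (j + x) U (j + y) ≡ insert x (λ z → U (j + z)) y
insert-shift zero x U y = refl
insert-shift (suc j) x U y = insert-shift j x (U ∘ suc) y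

count-Scan-cong : ∀ {n n′} m U K {i i′ b b′ a a′} → n ≡ n′ → i ≡ i′ → b ≡ b′ → a ≡ a′ →
  count n m (Scan U i b a K) ≡ count n′ m (Scan U i′ b′ a′ K)
count-Scan-cong m U K refl refl refl refl = refl

-- Removing a closed prefix: if exactly the values 0, …, j-1 were used in the
-- first j positions, the remaining scan is the scan of a word shifted down by j.
cut : ∀ j n m U U′ i b a K → (∀ x → x < j → U x ≡ true) → (∀ x → U (j + x) ≡ U′ x) →
  count (j + n) m (Scan U (j + i) (j + b) a K) ≡ count n m (Scan U′ i b a K)
cut j n zero U U′ i b a K full rest = refl
cut j n (suc m) U U′ i b a K full rest = begin
  sumTo (j + n) child                              ≡⟨ sumTo-+ j n child ⟩
  sumTo j child + sumTo n (λ y → child (j + y))    ≡⟨ cong₂ _+_ (sumTo-zero j usedChild) (sumTo-cong n (λ y _ → shifted y)) ⟩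
  sumTo n child′                                   ∎
  where
  open ≡-Reasoning
  next : ℕ → List ℕ → Bool
  next x = Scan (insert x U) (suc (j + i)) ((j + b) ⊔ suc x) (a + bit (isSF (j + i) (j + b) x)) K
  next′ : ℕ → List ℕ → Bool
  next′ y = Scan (insert y U′) (suc i) (b ⊔ suc y) (a + bit (isSF i b y)) K
  child : ℕ → ℕ
  child x = count (j + n) m (λ l → not (U x) ∧ next x l)
  child′ : ℕ → ℕ
  child′ y = count n m (λ l → not (U′ y) ∧ next′ y l)
  usedChild : ∀ x → x < j → child x ≡ 0
  usedChild x x<j rewrite full x x<j = count-used (j + n) m (next x)
  shifted : ∀ y → child (j + y) ≡ child′ y
  shifted y with U′ y in eq
  ... | true rewrite rest y | eq = trans (count-used (j + n) m (next (j + y))) (sym (count-used n m (next′ y)))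
  ... | false rewrite rest y | eq = trans
    (count-Scan-cong m (insert (j + y) U) K refl (sym (+-suc j i))
      (trans (cong ((j + b) ⊔_) (sym (+-suc j y))) (sym (+-distribˡ-⊔ j b (suc y))))
      (cong (λ c → a + bit c) (isSF-shift j i b y)))
    (cut j n m (insert (j + y) U) (insert y U′) (suc i) (b ⊔ suc y) (a + bit (isSF i b y)) K full′ rest′)
    where
    full′ : ∀ x → x < j → insert (j + y) U x ≡ true
    full′ x x<j rewrite full x x<j = ∨-zeroʳ (x ≡ᵇ j + y)
    rest′ : ∀ x → insert (j + y) U (j + x) ≡ insert y U′ x
    rest′ x = trans (insert-shift j y U x) (cong ((x ≡ᵇ y) ∨_) (rest x))

-- A block is closed at position c
-- as soon as the c values read are all below c, hence equal to 0, …, c-1.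

used : ℕ → (ℕ → Bool) → ℕ
used n U = sumTo n (λ y → bit (U y))

Below : ℕ → (ℕ → Bool) → Set
Below b U = ∀ y → b ≤ y → U y ≡ false

used≤ : ∀ n U → used n U ≤ n
used≤ zero U = z≤n
used≤ (suc n) U = +-mono-≤ (bit≤1 (U 0)) (used≤ n (U ∘ suc))

used-full : ∀ n U → used n U ≡ n → ∀ y → y < n → U y ≡ true
used-full (suc n) U e y y<n with U 0 in eq0
used-full (suc n) U e zero _ | true = eq0
used-full (suc n) U e (suc y) (s<s y<n) | true = used-full n (U ∘ suc) (suc-injective e) y y<n
used-full (suc n) U e y _ | false = ⊥-elim (<⇒≱ (≤-reflexive (sym e)) (used≤ n (U ∘ suc)))

used-insert : ∀ n x U → x < n → U x ≡ false → used n (insert x U) ≡ suc (used n U)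
used-insert (suc n) zero U _ eq0 rewrite eq0 = refl
used-insert (suc n) (suc x) U (s<s x<n) eqx =
  trans (cong (bit (U 0) +_) (used-insert n x (U ∘ suc) x<n eqx)) (+-suc (bit (U 0)) _)

used-beyond : ∀ b d U → Below b U → used (b + d) U ≡ used b U
used-beyond b d U below = begin
  used (b + d) U
    ≡⟨ sumTo-+ b d _ ⟩
  used b U + sumTo d (λ y → bit (U (b + y)))
    ≡⟨ cong (used b U +_) (sumTo-zero d (λ y _ → cong bit (below (b + y) (m≤m+n b y)))) ⟩
  used b U + 0
    ≡⟨ +-identityʳ _ ⟩
  used b U ∎
  where open ≡-Reasoning

Below-insert : ∀ b x U → Below b U → Below (b ⊔ suc x) (insert x U)
Below-insert b x U below y b′≤y = trans
  (cong (_∨ U y) (¬-not (λ y≡x → <⇒≱ (≤-trans (m≤n⊔m b (suc x)) b′≤y) (≤-reflexive (≡ᵇ⇒≡ y x (T-true y≡x))))))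
  (below y (≤-trans (m≤m⊔n b (suc x)) b′≤y))

used-extend : ∀ b x U → Below b U → U x ≡ false → used (b ⊔ suc x) (insert x U) ≡ suc (used b U)
used-extend b x U below fresh = begin
  used (b ⊔ suc x) (insert x U)      ≡⟨ used-insert (b ⊔ suc x) x U (m≤n⊔m b (suc x)) fresh ⟩
  suc (used (b ⊔ suc x) U)           ≡⟨ cong (λ n → suc (used n U)) (sym (m+[n∸m]≡n (m≤m⊔n b (suc x)))) ⟩
  suc (used (b + (b ⊔ suc x ∸ b)) U) ≡⟨ cong suc (used-beyond b _ U below) ⟩
  suc (used b U)                     ∎
  where open ≡-Reasoning

record OpenState (E : ℕ) (U : ℕ → Bool) (i b : ℕ) : Set where
  field
    unclosed : i < b
    bounded  : b ≤ E
    below    : Below b U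
    size     : used b U ≡ i

-- All positions at which the block read from an open state can close, when
-- only values below E are allowed (r bounds the remaining steps, E = i + r).
mutual
  blockEndsFrom : ℕ → ℕ → (ℕ → Bool) → ℕ → ℕ → List ℕ
  blockEndsFrom E zero U i b = []
  blockEndsFrom E (suc r) U i b = concatTo E (childEnds E r U i b)

  childEnds : ℕ → ℕ → (ℕ → Bool) → ℕ → ℕ → ℕ → List ℕ
  childEnds E r U i b x =
    if U x then [] else
    if b ⊔ suc x ≤ᵇ suc i then suc i ∷ [] else
    blockEndsFrom E r (insert x U) (suc i) (b ⊔ suc x)

OpenState-step : ∀ {E U i b} x → OpenState E U i b → x < E → U x ≡ false →
  (b ⊔ suc x ≤ᵇ suc i) ≡ false → OpenState E (insert x U) (suc i) (b ⊔ suc x)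
OpenState-step {E} {U} {i} {b} x st x<E fresh stays = record
  { unclosed = ≤ᵇ-false (b ⊔ suc x) (suc i) stays
  ; bounded  = ⊔-lub bounded x<E
  ; below    = Below-insert b x U below
  ; size     = trans (used-extend b x U below fresh) (cong suc size)
  }
  where open OpenState st

count-closing : ∀ {E U i b} r k x → suc i + r ≡ E → OpenState E U i b → U x ≡ false →
  (b ⊔ suc x ≤ᵇ suc i) ≡ true →
  count (E + k) (r + k) (Scan (insert x U) (suc i) (b ⊔ suc x) 0 k) ≡ Count (E ∸ suc i + k) k
count-closing {E} {U} {i} {b} r k x refl st fresh closes = begin
  count (E + k) (r + k) (Scan U′ (suc i) b′ 0 k)
     ≡⟨ count-Scan-cong (r + k) U′ k (+-assoc (suc i) r k) (sym (+-identityʳ (suc i)))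
                        (trans b′≡ (sym (+-identityʳ (suc i)))) refl ⟩
  count (suc i + (r + k)) (r + k) (Scan U′ (suc i + 0) (suc i + 0) 0 k)
     ≡⟨ cut (suc i) (r + k) (r + k) U′ none 0 0 0 k full rest ⟩
  Count (r + k) k
     ≡⟨ cong (λ e → Count (e + k) k) (sym (m+n∸m≡n (suc i) r)) ⟩
  Count (E ∸ suc i + k) k ∎
  where
  open ≡-Reasoning
  open OpenState st
  U′ = insert x U
  b′ = b ⊔ suc x
  size′ : used b′ U′ ≡ suc i
  size′ = trans (used-extend b x U below fresh) (cong suc size)
  b′≡ : b′ ≡ suc i
  b′≡ = ≤-antisym (≤ᵇ⇒≤ b′ (suc i) (T-true closes)) (subst (_≤ b′) size′ (used≤ b′ U′))
  full : ∀ y → y < suc i → U′ y ≡ true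
  full = used-full (suc i) U′ (subst (λ n → used n U′ ≡ suc i) b′≡ size′)
  rest : ∀ y → U′ (suc i + y) ≡ false
  rest y = Below-insert b x U below (suc i + y) (subst (_≤ suc i + y) (sym b′≡) (m≤m+n (suc i) y))

child-dead : ∀ n m U i b a K x → a + bit (isSF i b x) + (m ∸ ((b ⊔ suc x) ∸ suc i)) < K →
  count n m (λ l → Scan U i b a K (x ∷ l)) ≡ 0
child-dead n m U i b a K x short with U x
... | true = count-used n m (Scan (insert x U) (suc i) (b ⊔ suc x) (a + bit (isSF i b x)) K)
... | false = Scan-dead n m (insert x U) (suc i) (b ⊔ suc x) _ K short

budget-exhausted : ∀ r k y d → r + suc y ≤ d → y < k → (r + k) ∸ d < k
budget-exhausted r (suc k) y d r+y<d (s<s y≤k) = begin-strict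
  (r + suc k) ∸ d              ≤⟨ ∸-monoʳ-≤ (r + suc k) r+y<d ⟩
  (r + suc k) ∸ (r + suc y)    ≡⟨ [m+n]∸[m+o]≡n∸o r (suc k) (suc y) ⟩
  k ∸ y                        <⟨ s≤s (m∸n≤m k y) ⟩
  suc k                        ∎
  where open ≤-Reasoning

open-deficit : ∀ E r i b y → i + suc r ≡ E → r + suc y ≤ (b ⊔ suc (E + y)) ∸ suc i
open-deficit E r i b y i+r≡E = begin
  r + suc y                  ≡⟨ +-suc r y ⟩
  suc r + y                  ≡⟨ sym (m+n∸m≡n i (suc r + y)) ⟩
  (i + (suc r + y)) ∸ i      ≡⟨ cong (_∸ i) (trans (sym (+-assoc i (suc r) y)) (cong (_+ y) i+r≡E)) ⟩
  (E + y) ∸ i                ≤⟨ ∸-monoˡ-≤ (suc i) (m≤n⊔m b (suc (E + y))) ⟩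
  (b ⊔ suc (E + y)) ∸ suc i  ∎
  where open ≤-Reasoning

count-open : ∀ E r k U i b → i + r ≡ E → OpenState E U i b →
  count (E + k) (r + k) (Scan U i b 0 k) ≡ weigh (λ c → Count (E ∸ c + k) k) (blockEndsFrom E r U i b)
count-open E zero k U i b i+0≡E st =
  ⊥-elim (<⇒≱ (<-≤-trans unclosed bounded) (≤-reflexive (trans (sym i+0≡E) (+-identityʳ i))))
  where open OpenState st
count-open E (suc r) k U i b i+r≡E st = begin
  sumTo (E + k) child                                  ≡⟨ sumTo-+ E k child ⟩
  sumTo E child + sumTo k (λ y → child (E + y))        ≡⟨ cong₂ _+_ (sumTo-cong E live) (sumTo-zero k dead) ⟩
  sumTo E (λ x → weigh w (childEnds E r U i b x)) + 0  ≡⟨ +-identityʳ _ ⟩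
  sumTo E (λ x → weigh w (childEnds E r U i b x))      ≡⟨ sym (weigh-concatTo w E (childEnds E r U i b)) ⟩
  weigh w (concatTo E (childEnds E r U i b))           ∎
  where
  open ≡-Reasoning
  open OpenState st
  w : ℕ → ℕ
  w c = Count (E ∸ c + k) k
  child : ℕ → ℕ
  child x = count (E + k) (r + k) (λ l → Scan U i b 0 k (x ∷ l))
  E≡ : suc i + r ≡ E
  E≡ = trans (sym (+-suc i r)) i+r≡E
  dead : ∀ y → y < k → child (E + y) ≡ 0
  dead y y<k = child-dead (E + k) (r + k) U i b 0 k (E + y)
    (subst (λ c → bit c + ((r + k) ∸ ((b ⊔ suc (E + y)) ∸ suc i)) < k) (sym (isSF-open (E + y) unclosed))
      (budget-exhausted r k y _ (open-deficit E r i b y i+r≡E) y<k))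
  live : ∀ x → x < E → child x ≡ weigh w (childEnds E r U i b x)
  live x x<E with U x in fresh
  ... | true = count-used (E + k) (r + k) (Scan (insert x U) (suc i) (b ⊔ suc x) (0 + bit (isSF i b x)) k)
  ... | false rewrite isSF-open x unclosed with b ⊔ suc x ≤ᵇ suc i in closes
  ...   | true = trans (count-closing r k x E≡ st fresh closes) (sym (+-identityʳ _))
  ...   | false = count-open E r k (insert x U) (suc i) (b ⊔ suc x) E≡ (OpenState-step x st x<E fresh closes)

-- Value 0 is a strong fixed point
-- followed by a permutation of [n] with one strong fixed point fewer; a value
-- y+1 opens a block.
fixedFirst : ℕ → ℕ → ℕ
fixedFirst n zero = 0
fixedFirst n (suc K) = Count n K

openingWith : ℕ → ℕ → ℕ → ℕ
openingWith n K y = count (suc n) n (Scan (insert (suc y) none) 1 (suc (suc y)) 0 K)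

Count-first-value : ∀ n K → Count (suc n) K ≡ fixedFirst n K + sumTo n (openingWith n K)
Count-first-value n K = cong (_+ sumTo n (openingWith n K)) (startsWithZero K)
  where
  startsWithZero : ∀ K → count (suc n) n (Scan (insert 0 none) 1 1 1 K) ≡ fixedFirst n K
  startsWithZero K =
    trans (cut 1 n n (insert 0 none) none 0 0 1 K (λ { zero _ → refl ; (suc _) (s≤s ()) }) (λ _ → refl)) (shift K)
    where
    shift : ∀ K → count n n (Scan none 0 0 1 K) ≡ fixedFirst n K
    shift zero = count-none n n _ (λ l _ → Scan-overshoot none 0 0 0 l)
    shift (suc K) = count-cong n n (Scan-shift none 0 0 0 K)

-- Only the identity has all points strongly fixed.
Count-identity : ∀ k → Count (suc k) (suc k) ≡ Count k k
Count-identity k = begin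
  Count (suc k) (suc k)                             ≡⟨ Count-first-value k (suc k) ⟩
  Count k k + sumTo k (openingWith k (suc k))       ≡⟨ cong (Count k k +_) (sumTo-zero k dead) ⟩
  Count k k + 0                                     ≡⟨ +-identityʳ _ ⟩
  Count k k                                         ∎
  where
  open ≡-Reasoning
  dead : ∀ y → y < k → openingWith k (suc k) y ≡ 0
  dead y _ = Scan-dead (suc k) k _ 1 (suc (suc y)) 0 (suc k) (s≤s (m∸n≤m k (suc y)))

-- One entry c for each possible first block of length c ≥ 2 (a block on the
-- values 0, …, c-1 with no proper closed prefix), for permutations with e
-- points that are not strongly fixed; only c ≤ e can occur.
blockEnds : ℕ → List ℕ
blockEnds zero = []
blockEnds (suc E) = concatTo E (λ y → blockEndsFrom (suc E) E (insert (suc y) none) 1 (suc (suc y)))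

first-block : ∀ E k →
  Count (suc E + k) k ≡ fixedFirst (E + k) k + weigh (λ c → Count (suc E ∸ c + k) k) (blockEnds (suc E))
first-block E k = begin
  Count (suc E + k) k                                        ≡⟨ Count-first-value (E + k) k ⟩
  fixedFirst (E + k) k + sumTo (E + k) child                 ≡⟨ cong (fixedFirst (E + k) k +_) split ⟩
  fixedFirst (E + k) k + weigh w (blockEnds (suc E))         ∎
  where
  open ≡-Reasoning
  w : ℕ → ℕ
  w c = Count (suc E ∸ c + k) k
  child : ℕ → ℕ
  child = openingWith (E + k) k
  ends : ℕ → List ℕ
  ends y = blockEndsFrom (suc E) E (insert (suc y) none) 1 (suc (suc y))
  live : ∀ y → y < E → child y ≡ weigh w (ends y)
  live y y<E = count-open (suc E) E k (insert (suc y) none) 1 (suc (suc y)) refl record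
    { unclosed = s<s z<s
    ; bounded  = s≤s y<E
    ; below    = Below-insert 0 (suc y) none (λ _ _ → refl)
    ; size     = used-extend 0 (suc y) none (λ _ _ → refl) refl
    }
  dead : ∀ z → z < k → child (E + z) ≡ 0
  dead z z<k = Scan-dead (suc E + k) (E + k) _ 1 (suc (suc (E + z))) 0 k
    (budget-exhausted E k z _ (≤-reflexive (+-suc E z)) z<k)
  split : sumTo (E + k) child ≡ weigh w (blockEnds (suc E))
  split = begin
    sumTo (E + k) child                                ≡⟨ sumTo-+ E k child ⟩
    sumTo E child + sumTo k (λ z → child (E + z))      ≡⟨ cong₂ _+_ (sumTo-cong E live) (sumTo-zero k dead) ⟩
    sumTo E (λ y → weigh w (ends y)) + 0               ≡⟨ +-identityʳ _ ⟩
    sumTo E (λ y → weigh w (ends y))                   ≡⟨ sym (weigh-concatTo w E ends) ⟩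
    weigh w (blockEnds (suc E))                        ∎

S : ℕ → ℕ → ℕ
S e k = Count (e + k) k

S-suc : ∀ E k → S (suc E) (suc k) ≡ S (suc E) k + weigh (λ c → S (suc E ∸ c) (suc k)) (blockEnds (suc E))
S-suc E k = trans (first-block E (suc k))
  (cong (_+ weigh (λ c → S (suc E ∸ c) (suc k)) (blockEnds (suc E))) (cong (λ n → Count n k) (+-suc E k)))

S-zero : ∀ E → S (suc E) 0 ≡ weigh (λ c → S (suc E ∸ c) 0) (blockEnds (suc E))
S-zero E = first-block E 0

S0 : ∀ k → S 0 k ≡ 1
S0 zero = refl
S0 (suc k) = trans (Count-identity k) (S0 k)

-- No permutation has exactly one point that is not strongly fixed (blockEnds 1 = []).
S1 : ∀ k → S 1 k ≡ 0
S1 zero = S-zero 0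
S1 (suc k) = trans (S-suc 0 k) (trans (+-identityʳ _) (S1 k))

-- The only first block of length ≥ 2 inside two non-fixed points is (1 0).
S2 : ∀ k → S 2 k ≡ suc k
S2 zero = S-zero 1
S2 (suc k) = begin
  S 2 (suc k)               ≡⟨ S-suc 1 k ⟩
  S 2 k + (S 0 (suc k) + 0) ≡⟨ cong₂ (λ p q → p + (q + 0)) (S2 k) (S0 (suc k)) ⟩
  suc k + 1                 ≡⟨ +-comm (suc k) 1 ⟩
  suc (suc k)               ∎
  where open ≡-Reasoning

-- By enumeration: one first block of length 2, three of length 3 and thirteen
-- (the indecomposable permutations of [4]) of length 4.
blockEnds-4 : blockEnds 4 ≡ 2 ∷ 3 ∷ 4 ∷ 4 ∷ 4 ∷ 3 ∷ 4 ∷ 3 ∷ 4 ∷ 4 ∷ 4 ∷ 4 ∷ 4 ∷ 4 ∷ 4 ∷ 4 ∷ 4 ∷ []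
blockEnds-4 = refl

-- S 2 k + 3 S 1 k + 13 S 0 k = (k + 1) + 0 + 13.
blocks-4 : ∀ k → weigh (λ c → S (4 ∸ c) k) (blockEnds 4) ≡ k + 14
blocks-4 k rewrite blockEnds-4 | S2 k | S1 k | S0 k = sym (+-suc k 13)

-- Summing S 4 k = S 4 (k-1) + k + 14 with S 4 0 = 14.
S4-double : ∀ k → 2 * S 4 k ≡ (k + 1) * (k + 28)
S4-double zero = cong (2 *_) (trans (S-zero 3) (blocks-4 0))
S4-double (suc k) = begin
  2 * S 4 (suc k)                        ≡⟨ cong (2 *_) (trans (S-suc 3 k) (cong (S 4 k +_) (blocks-4 (suc k)))) ⟩
  2 * (S 4 k + (suc k + 14))             ≡⟨ *-distribˡ-+ 2 (S 4 k) (suc k + 14) ⟩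
  2 * S 4 k + 2 * (suc k + 14)           ≡⟨ cong (_+ 2 * (suc k + 14)) (S4-double k) ⟩
  (k + 1) * (k + 28) + 2 * (suc k + 14)  ≡⟨ expand k ⟩
  (suc k + 1) * (suc k + 28)             ∎
  where
  open ≡-Reasoning
  expand : ∀ k → (k + 1) * (k + 28) + 2 * ((1 + k) + 14) ≡ ((1 + k) + 1) * ((1 + k) + 28)
  expand = solve-∀

corollary4 : ∀ (k : ℕ) → St (k + 4) k ≡ ((k + 1) * (k + 28)) / 2
corollary4 k = begin
  St (k + 4) k                    ≡⟨ St-Count (k + 4) k ⟩
  Count (k + 4) k                 ≡⟨ cong (λ n → Count n k) (+-comm k 4) ⟩
  S 4 k                           ≡⟨ sym (m*n/n≡m (S 4 k) 2) ⟩
  (S 4 k * 2) / 2                 ≡⟨ cong (_/ 2) (trans (*-comm (S 4 k) 2) (S4-double k)) ⟩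
  ((k + 1) * (k + 28)) / 2        ∎
  where open ≡-Reasoning
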